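{- Let $M=(E,\rho)$ be a matroid, and let $F\subseteq E$ be a set with $F^\vee\subseteq F$. Then the following are equivalent: (i) $F$ is a flat. (ii) $F^\vee=1_{\mathcal{Z}(F)}$, i.e. $F^\vee=\mathrm{cyc}(\mathrm{cl}(F))$. (iii) For every $Z\in\mathcal{Z}'(F)-\{F^\vee\}$ it holds that $|F\cap Z|-\rho(Z)<\eta(F^\vee)$. (iv) Every set $B$ with $F^\vee\subseteq B\subseteq F$ is a flat, and if $F\subsetneq F^\wedge$ then $|F|-\rho(F^\wedge)<\eta(F^\vee)$. (v) For every set $B$ with $F^\vee\subseteq B\subseteq F$ and $B\subsetneq B^\wedge$ it holds that $|B|-\rho(B^\wedge)<\eta(B^\vee)$.
   Context: A matroid $M=(E,\rho)$ is given by its rank function; $\eta(X)=|X|-\rho(X)$ is the nullity. The closure operator is $\mathrm{cl}(X)=\{e\in E:\rho(X\cup e)=\rho(X)\}$, the cyclic operator is $\mathrm{cyc}(X)=\{e\in X:\rho(X-e)=\rho(X)\}$; $X$ is a flat if $\mathrm{cl}(X)=X$ and a cyclic flat if moreover $\mathrm{cyc}(X)=X$. $\mathcal{Z}(M)$ is the lattice of cyclic flats under inclusion, with join $X\vee Y=\mathrm{cl}(X\cup Y)$ and meet $X\wedge Y=\mathrm{cyc}(X\cap Y)$. For $A\subseteq E$: $A^\vee$ is the join in $\mathcal{Z}(M)$ of all cyclic flats contained in $A$, and $A^\wedge$ is the meet in $\mathcal{Z}(M)$ of all cyclic flats containing $A$. $\mathcal{Z}(A)$ denotes the interval $[\mathrm{cl}(\mathrm{cyc}(A)),\mathrm{cyc}(\mathrm{cl}(A))]$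 of $\mathcal{Z}(M)$, with top element $1_{\mathcal{Z}(A)}=\mathrm{cyc}(\mathrm{cl}(A))$, and $\mathcal{Z}'(A)$ denotes the interval $[A^\vee,A^\wedge]$ of $\mathcal{Z}(M)$. -}

module Defs where

open import Data.Nat using (ℕ; _≤_; _<_; _∸_; _+_)
import Data.Nat as ℕ
open import Data.Bool using (Bool; true; false; _∧_; if_then_else_)
import Data.Bool as B
open import Data.Fin using (Fin)
open import Data.Fin.Subset using (Subset; _⊆_; _⊂_; _∪_; _∩_; _-_; ⁅_⁆; ∣_∣; ⊥; ⊤; inside; outside)
open import Data.Fin.Subset.Properties using (_⊆?_)
open import Data.Vec using (Vec; []; _∷_; tabulate; lookup)
open import Data.Vec.Properties using (≡-dec)
open import Data.List using (List; []; _∷_; foldr; filter; map; _++_)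
open import Relation.Nullary using (Dec; yes; no; ¬_)
open import Relation.Nullary.Decidable using (⌊_⌋; _×-dec_)
open import Relation.Binary.PropositionalEquality using (_≡_)
open import Data.Product using (_×_)
open import Function.Bundles using (_⇔_)

record Matroid (n : ℕ) : Set where
  field
    ρ          : Subset n → ℕ
    ρ-bounded  : ∀ X → ρ X ≤ ∣ X ∣
    ρ-mono     : ∀ {X Y} → X ⊆ Y → ρ X ≤ ρ Y
    ρ-submod   : ∀ X Y → ρ (X ∪ Y) + ρ (X ∩ Y) ≤ ρ X + ρ Y

module _ {n : ℕ} (M : Matroid n) where
  open Matroid M

  _≟ˢ_ : (X Y : Subset n) → Dec (X ≡ Y)
  _≟ˢ_ = ≡-dec B._≟_

  η : Subset n → ℕ
  η X = ∣ X ∣ ∸ ρ X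

  cl : Subset n → Subset n
  cl X = tabulate (λ e → ⌊ ρ (X ∪ ⁅ e ⁆) ℕ.≟ ρ X ⌋)

  cyc : Subset n → Subset n
  cyc X = tabulate (λ e → lookup X e ∧ ⌊ ρ (X - e) ℕ.≟ ρ X ⌋)

  IsFlat : Subset n → Set
  IsFlat X = cl X ≡ X

  IsCyclicFlat : Subset n → Set
  IsCyclicFlat X = cl X ≡ X × cyc X ≡ X

  isCyclicFlat? : (X : Subset n) → Dec (IsCyclicFlat X)
  isCyclicFlat? X = (cl X ≟ˢ X) ×-dec (cyc X ≟ˢ X)

  _∨ᶻ_ : Subset n → Subset n → Subset n
  X ∨ᶻ Y = cl (X ∪ Y)

  _∧ᶻ_ : Subset n → Subset n → Subset n
  X ∧ᶻ Y = cyc (X ∩ Y)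

  0ᶻ : Subset n
  0ᶻ = cl ⊥

  1ᶻ : Subset n
  1ᶻ = cyc ⊤

allSubsets : (n : ℕ) → List (Subset n)
allSubsets ℕ.zero = [] ∷ []
allSubsets (ℕ.suc n) = map (outside ∷_) (allSubsets n) ++ map (inside ∷_) (allSubsets n)

module _ {n : ℕ} (M : Matroid n) where

  _^∨ : Subset n → Subset n
  A ^∨ = foldr (_∨ᶻ_ M) (0ᶻ M)
           (filter (λ Z → isCyclicFlat? M Z ×-dec (Z ⊆? A)) (allSubsets n))

  _^∧ : Subset n → Subset n
  A ^∧ = foldr (_∧ᶻ_ M) (1ᶻ M)
           (filter (λ Z → isCyclicFlat? M Z ×-dec (A ⊆? Z)) (allSubsets n))

  _∈Z′_ : Subset n → Subset n → Set
  Z ∈Z′ A = IsCyclicFlat M Z × (A ^∨ ⊆ Z) × (Z ⊆ A ^∧)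

-- For a flat F, the cyclic flats contained in F are those contained in cyc F, so
-- F^∨ = cyc F and every element of F outside F^∨ is a coloop of F.  Hence every B
-- with F^∨ ⊆ B ⊆ F is again flat, and for a cyclic flat Z ⊋ F^∨ the set F ∩ Z has
-- nullity at most η(F^∨) but rank below ρ(Z) (otherwise Z ⊆ cl(F ∩ Z) ⊆ F, i.e.
-- Z ⊆ F^∨); with |Y| = η(Y) + ρ(Y) this gives (iii), (iv) and (v).  Conversely, an
-- element e ∈ cl F − F is not a coloop of cl F, so it lies in Zᶠ = cyc(cl F) but not
-- in F^∨.  The elements of cl F outside Zᶠ are coloops, so ρ(Zᶠ) ≤ ρ(F ∩ Zᶠ); then Zᶠ
-- violates (iii) and F ∩ Zᶠ, whose closure contains Zᶠ, violates (v).

module Submission where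

open import Defs
open import Data.Nat using (ℕ; _<_; _+_)
open import Data.Fin.Subset using (Subset; _⊆_; _⊂_; _∩_; ∣_∣)
open import Data.Product using (_×_)
open import Function.Bundles using (_⇔_)
open import Relation.Binary.PropositionalEquality using (_≡_; _≢_)

open import Data.Bool using (Bool; T)
open import Data.Bool.Properties using (T-≡; T-∧)
open import Data.Fin using (Fin; zero; suc)
open import Data.Fin.Subset
  using (_∈_; _∉_; _∪_; _─_; _-_; ⁅_⁆; ⊥; ⊤; inside; outside; Empty)
open import Data.Fin.Subset.Properties
open import Data.Fin.Subset.Induction using (⊂-wellFounded)
open import Data.List using (map)
import Data.List.Membership.Propositional as List
open import Data.List.Membership.Propositional.Properties
  using (∈-map⁺; ∈-++⁺ˡ; ∈-++⁺ʳ; ∈-filter⁺)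
open import Data.List.Properties using (foldr-preservesᵇ; foldr-preservesᵒ)
import Data.List.Relation.Unary.All as All
open import Data.List.Relation.Unary.All.Properties using (all-filter)
import Data.List.Relation.Unary.Any as Any
open import Data.Nat using (suc; _≤_; _∸_; s≤s)
open import Data.Nat.Properties
open import Data.Product using (_,_; proj₁; proj₂)
open import Data.Sum using (_⊎_; inj₁; inj₂)
open import Data.Vec using (_∷_; []; lookup; tabulate; here; there)
open import Data.Vec.Properties using (lookup∘tabulate; []=⇒lookup; lookup⇒[]=)
open import Function.Base using (_∘_)
open import Function.Bundles using (mk⇔; Equivalence)
import Induction.WellFounded as WF
open import Relation.Nullary using (Dec; yes; no; ¬_; contradiction)
open import Relation.Nullary.Decidable using (toWitness; fromWitness; _×-dec_)
open import Relation.Binary.PropositionalEquality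
  using (refl; sym; trans; cong; subst; module ≡-Reasoning)

private
  variable
    n : ℕ
    p q r : Subset n
    x : Fin n

x∈p─q⇒x∉q : ∀ (p q : Subset n) → x ∈ p ─ q → x ∉ q
x∈p─q⇒x∉q {x = zero}  (_ ∷ p) (inside  ∷ q) () here
x∈p─q⇒x∉q {x = zero}  (_ ∷ p) (outside ∷ q) _  ()
x∈p─q⇒x∉q {x = suc x} (_ ∷ p) (_       ∷ q) (there x∈p─q) (there x∈q) = x∈p─q⇒x∉q p q x∈p─q x∈q

Empty[p─q]⇒p⊆q : Empty (p ─ q) → p ⊆ q
Empty[p─q]⇒p⊆q {q = q} p─q-empty {x} x∈p with x ∈? q
... | yes x∈q = x∈q
... | no  x∉q = contradiction (x , x∈p∧x∉q⇒x∈p─q x∈p x∉q) p─q-empty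

∪-lub : p ⊆ r → q ⊆ r → p ∪ q ⊆ r
∪-lub {p = p} {q = q} p⊆r q⊆r x∈p∪q with x∈p∪q⁻ p q x∈p∪q
... | inj₁ x∈p = p⊆r x∈p
... | inj₂ x∈q = q⊆r x∈q

∩-glb : r ⊆ p → r ⊆ q → r ⊆ p ∩ q
∩-glb r⊆p r⊆q x∈r = x∈p∩q⁺ (r⊆p x∈r , r⊆q x∈r)

x∈p⇒⁅x⁆⊆p : x ∈ p → ⁅ x ⁆ ⊆ p
x∈p⇒⁅x⁆⊆p {x = x} x∈p y∈⁅x⁆ = subst (_∈ _) (sym (x∈⁅y⁆⇒x≡y x y∈⁅x⁆)) x∈p

─-monoˡ : p ⊆ q → p ─ r ⊆ q ─ r
─-monoˡ {p = p} {r = r} p⊆q x∈p─r =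
  x∈p∧x∉q⇒x∈p─q (p⊆q (p─q⊆p p r x∈p─r)) (x∈p─q⇒x∉q p r x∈p─r)

p⊆q∪[p─q] : ∀ (p q : Subset n) → p ⊆ q ∪ (p ─ q)
p⊆q∪[p─q] p q {x} x∈p with x ∈? q
... | yes x∈q = x∈p∪q⁺ (inj₁ x∈q)
... | no  x∉q = x∈p∪q⁺ (inj₂ (x∈p∧x∉q⇒x∈p─q x∈p x∉q))

p⊆[p-x]∪⁅x⁆ : p ⊆ (p - x) ∪ ⁅ x ⁆
p⊆[p-x]∪⁅x⁆ {p = p} {x = x} = subst (p ⊆_) (∪-comm ⁅ x ⁆ (p - x)) (p⊆q∪[p─q] p ⁅ x ⁆)

x∈p⇒[p-x]∪⁅x⁆⊆p : x ∈ p → (p - x) ∪ ⁅ x ⁆ ⊆ p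
x∈p⇒[p-x]∪⁅x⁆⊆p {x = x} {p = p} x∈p = ∪-lub (p─q⊆p p ⁅ x ⁆) (x∈p⇒⁅x⁆⊆p x∈p)

x∈p-y⇒x≢y : ∀ (p : Subset n) {y} → x ∈ p - y → x ≢ y
x∈p-y⇒x≢y p {y} x∈p-y refl = x∈p─q⇒x∉q p ⁅ y ⁆ x∈p-y (x∈⁅x⁆ y)

p⊆q∧x∉p⇒p⊆q-x : p ⊆ q → x ∉ p → p ⊆ q - x
p⊆q∧x∉p⇒p⊆q-x p⊆q x∉p y∈p = x∈p∧x≢y⇒x∈p-y (p⊆q y∈p) (λ { refl → x∉p y∈p })

[p-x]─[q-x]⊆p─q : ∀ (p q : Subset n) x → (p - x) ─ (q - x) ⊆ p ─ q
[p-x]─[q-x]⊆p─q p q x {y} y∈ = x∈p∧x∉q⇒x∈p─q (p─q⊆p p ⁅ x ⁆ y∈p-x)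
  (λ y∈q → x∈p─q⇒x∉q (p - x) (q - x) y∈ (x∈p∧x≢y⇒x∈p-y y∈q (x∈p-y⇒x≢y p y∈p-x)))
  where
  y∈p-x : y ∈ p - x
  y∈p-x = p─q⊆p (p - x) (q - x) y∈

p─[p∩q]⊆p─q : ∀ (p q : Subset n) → p ─ (p ∩ q) ⊆ p ─ q
p─[p∩q]⊆p─q p q {y} y∈ = x∈p∧x∉q⇒x∈p─q y∈p (λ y∈q → x∈p─q⇒x∉q p (p ∩ q) y∈ (x∈p∩q⁺ (y∈p , y∈q)))
  where
  y∈p : y ∈ p
  y∈p = p─q⊆p p (p ∩ q) y∈

∣p─q∣+∣p∩q∣≡∣p∣ : ∀ (p q : Subset n) → ∣ p ─ q ∣ + ∣ p ∩ q ∣ ≡ ∣ p ∣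
∣p─q∣+∣p∩q∣≡∣p∣ []            []            = refl
∣p─q∣+∣p∩q∣≡∣p∣ (inside  ∷ p) (inside  ∷ q) = trans (+-suc _ _) (cong suc (∣p─q∣+∣p∩q∣≡∣p∣ p q))
∣p─q∣+∣p∩q∣≡∣p∣ (inside  ∷ p) (outside ∷ q) = cong suc (∣p─q∣+∣p∩q∣≡∣p∣ p q)
∣p─q∣+∣p∩q∣≡∣p∣ (outside ∷ p) (inside  ∷ q) = ∣p─q∣+∣p∩q∣≡∣p∣ p q
∣p─q∣+∣p∩q∣≡∣p∣ (outside ∷ p) (outside ∷ q) = ∣p─q∣+∣p∩q∣≡∣p∣ p q

q⊆p⇒∣p─q∣+∣q∣≡∣p∣ : q ⊆ p → ∣ p ─ q ∣ + ∣ q ∣ ≡ ∣ p ∣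
q⊆p⇒∣p─q∣+∣q∣≡∣p∣ {q = q} {p = p} q⊆p =
  subst (λ s → ∣ p ─ q ∣ + ∣ s ∣ ≡ ∣ p ∣) p∩q≡q (∣p─q∣+∣p∩q∣≡∣p∣ p q)
  where
  p∩q≡q : p ∩ q ≡ q
  p∩q≡q = ⊆-antisym (p∩q⊆q p q) (∩-glb q⊆p ⊆-refl)

p⊆q⇒∣p─q∣≡0 : ∀ {n} {p q : Subset n} → p ⊆ q → ∣ p ─ q ∣ ≡ 0
p⊆q⇒∣p─q∣≡0 {n} {p} {q} p⊆q = n≤0⇒n≡0 (≤-trans (p⊆q⇒∣p∣≤∣q∣ p─q⊆⊥) (≤-reflexive (∣⊥∣≡0 n)))
  where
  p─q⊆⊥ : p ─ q ⊆ ⊥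
  p─q⊆⊥ x∈ = contradiction (p⊆q (p─q⊆p p q x∈)) (x∈p─q⇒x∉q p q x∈)

x∈p⇒1+∣p-x∣≡∣p∣ : x ∈ p → suc ∣ p - x ∣ ≡ ∣ p ∣
x∈p⇒1+∣p-x∣≡∣p∣ {x = x} {p = p} x∈p = begin
  suc ∣ p - x ∣         ≡⟨ +-comm 1 ∣ p - x ∣ ⟩
  ∣ p - x ∣ + 1         ≡⟨ cong (∣ p - x ∣ +_) (sym (∣⁅x⁆∣≡1 x)) ⟩
  ∣ p - x ∣ + ∣ ⁅ x ⁆ ∣ ≡⟨ q⊆p⇒∣p─q∣+∣q∣≡∣p∣ (x∈p⇒⁅x⁆⊆p x∈p) ⟩
  ∣ p ∣               ∎
  where open ≡-Reasoning

removal-induction : ∀ (X : Subset n) (P : Subset n → Set) →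
  (∀ {Y} → Y ⊆ X → P Y) →
  (∀ {Y x} → x ∈ Y → x ∉ X → P (Y - x) → P Y) →
  ∀ Y → P Y
removal-induction X P base step = WF.All.wfRec ⊂-wellFounded _ P rec
  where
  rec : ∀ Y → (∀ {Y′} → Y′ ⊂ Y → P Y′) → P Y
  rec Y ih with nonempty? (Y ─ X)
  ... | no  Y─X-empty   = base (Empty[p─q]⇒p⊆q Y─X-empty)
  ... | yes (x , x∈Y─X) = step x∈Y (x∈p─q⇒x∉q Y X x∈Y─X) (ih (x∈p⇒p-x⊂p x∈Y))
    where
    x∈Y : x ∈ Y
    x∈Y = p─q⊆p Y X x∈Y─X

∈tabulate⁺ : ∀ (f : Fin n → Bool) → T (f x) → x ∈ tabulate f
∈tabulate⁺ {x = x} f t = lookup⇒[]= x _ (trans (lookup∘tabulate f x) (Equivalence.to T-≡ t))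

∈tabulate⁻ : ∀ (f : Fin n → Bool) → x ∈ tabulate f → T (f x)
∈tabulate⁻ {x = x} f x∈ = Equivalence.from T-≡ (trans (sym (lookup∘tabulate f x)) ([]=⇒lookup x∈))

∈-allSubsets : ∀ (Z : Subset n) → Z List.∈ allSubsets n
∈-allSubsets []            = Any.here refl
∈-allSubsets {suc n} (outside ∷ Z) = ∈-++⁺ˡ (∈-map⁺ (outside ∷_) (∈-allSubsets Z))
∈-allSubsets {suc n} (inside  ∷ Z) =
  ∈-++⁺ʳ (map (outside ∷_) (allSubsets n)) (∈-map⁺ (inside ∷_) (∈-allSubsets Z))

module _ {n : ℕ} (M : Matroid n) where
  open Matroid M

  private
    variable
      A B C F G W X Y Z : Subset n
      e : Fin n

  IsCyclic : Subset n → Set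
  IsCyclic X = cyc M X ≡ X

  ρ[X∪S]≤∣S∣+ρX : ∀ X S → ρ (X ∪ S) ≤ ∣ S ∣ + ρ X
  ρ[X∪S]≤∣S∣+ρX X S = begin
    ρ (X ∪ S)             ≤⟨ m≤m+n _ _ ⟩
    ρ (X ∪ S) + ρ (X ∩ S) ≤⟨ ρ-submod X S ⟩
    ρ X + ρ S             ≤⟨ +-monoʳ-≤ (ρ X) (ρ-bounded S) ⟩
    ρ X + ∣ S ∣           ≡⟨ +-comm (ρ X) ∣ S ∣ ⟩
    ∣ S ∣ + ρ X           ∎
    where open ≤-Reasoning

  ρY≤∣Y─X∣+ρX : ∀ X Y → ρ Y ≤ ∣ Y ─ X ∣ + ρ X
  ρY≤∣Y─X∣+ρX X Y = ≤-trans (ρ-mono (p⊆q∪[p─q] Y X)) (ρ[X∪S]≤∣S∣+ρX X (Y ─ X))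

  ∈cl⁺ : ρ (X ∪ ⁅ e ⁆) ≤ ρ X → e ∈ cl M X
  ∈cl⁺ {e = e} ρ≤ = ∈tabulate⁺ _ (fromWitness (≤-antisym ρ≤ (ρ-mono (p⊆p∪q ⁅ e ⁆))))

  ∈cl⁻ : e ∈ cl M X → ρ (X ∪ ⁅ e ⁆) ≤ ρ X
  ∈cl⁻ e∈ = ≤-reflexive (toWitness (∈tabulate⁻ _ e∈))

  ∈cyc⁺ : e ∈ X → ρ X ≤ ρ (X - e) → e ∈ cyc M X
  ∈cyc⁺ {e = e} {X = X} e∈X ρ≤ = ∈tabulate⁺ _ (Equivalence.from (T-∧ {lookup X e})
    (Equivalence.from T-≡ ([]=⇒lookup e∈X) , fromWitness (≤-antisym (ρ-mono (p─q⊆p X ⁅ e ⁆)) ρ≤)))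

  ∈cyc⁻ : e ∈ cyc M X → ρ X ≤ ρ (X - e)
  ∈cyc⁻ {e = e} {X = X} e∈ =
    ≤-reflexive (sym (toWitness (proj₂ (Equivalence.to (T-∧ {lookup X e}) (∈tabulate⁻ _ e∈)))))

  cyc⊆ : cyc M X ⊆ X
  cyc⊆ {X = X} {x = e} e∈ =
    lookup⇒[]= e X (Equivalence.to T-≡ (proj₁ (Equivalence.to (T-∧ {lookup X e}) (∈tabulate⁻ _ e∈))))

  ∉cyc⇒ρ[X-e]<ρX : e ∈ X → e ∉ cyc M X → ρ (X - e) < ρ X
  ∉cyc⇒ρ[X-e]<ρX e∈X e∉cyc = ≰⇒> (λ ρX≤ → e∉cyc (∈cyc⁺ e∈X ρX≤))

  X⊆cl : X ⊆ cl M X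
  X⊆cl e∈X = ∈cl⁺ (ρ-mono (∪-lub ⊆-refl (x∈p⇒⁅x⁆⊆p e∈X)))

  cl-mono : X ⊆ Y → cl M X ⊆ cl M Y
  cl-mono {X} {Y} X⊆Y {e} e∈clX = ∈cl⁺ (+-cancelʳ-≤ (ρ X) _ _ (begin
    ρ (Y ∪ ⁅ e ⁆) + ρ X
      ≤⟨ +-mono-≤ (ρ-mono Y∪e⊆Y∪[X∪e]) (ρ-mono (∩-glb X⊆Y (p⊆p∪q ⁅ e ⁆))) ⟩
    ρ (Y ∪ (X ∪ ⁅ e ⁆)) + ρ (Y ∩ (X ∪ ⁅ e ⁆))
      ≤⟨ ρ-submod Y (X ∪ ⁅ e ⁆) ⟩
    ρ Y + ρ (X ∪ ⁅ e ⁆)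
      ≤⟨ +-monoʳ-≤ (ρ Y) (∈cl⁻ e∈clX) ⟩
    ρ Y + ρ X
      ∎))
    where
    open ≤-Reasoning
    Y∪e⊆Y∪[X∪e] : Y ∪ ⁅ e ⁆ ⊆ Y ∪ (X ∪ ⁅ e ⁆)
    Y∪e⊆Y∪[X∪e] = ∪-lub (p⊆p∪q (X ∪ ⁅ e ⁆)) (⊆-trans (q⊆p∪q X ⁅ e ⁆) (q⊆p∪q Y (X ∪ ⁅ e ⁆)))

  e∈clX⇒ρY≤ρ[Y-e] : X ⊆ Y - e → e ∈ cl M X → ρ Y ≤ ρ (Y - e)
  e∈clX⇒ρY≤ρ[Y-e] {Y = Y} {e = e} X⊆Y-e e∈clX = begin
    ρ Y                 ≤⟨ ρ-mono p⊆[p-x]∪⁅x⁆ ⟩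
    ρ ((Y - e) ∪ ⁅ e ⁆) ≤⟨ ∈cl⁻ (cl-mono X⊆Y-e e∈clX) ⟩
    ρ (Y - e)           ∎
    where open ≤-Reasoning

  ∈cyc⇒∈cl[X-e] : e ∈ cyc M X → e ∈ cl M (X - e)
  ∈cyc⇒∈cl[X-e] e∈cyc = ∈cl⁺ (≤-trans (ρ-mono (x∈p⇒[p-x]∪⁅x⁆⊆p (cyc⊆ e∈cyc))) (∈cyc⁻ e∈cyc))

  cl-least : X ⊆ W → IsFlat M W → cl M X ⊆ W
  cl-least X⊆W W-flat e∈ = subst (_ ∈_) W-flat (cl-mono X⊆W e∈)

  ρY≤ρX⇒Y⊆clX : X ⊆ Y → ρ Y ≤ ρ X → Y ⊆ cl M X
  ρY≤ρX⇒Y⊆clX X⊆Y ρY≤ρX e∈Y = ∈cl⁺ (≤-trans (ρ-mono (∪-lub X⊆Y (x∈p⇒⁅x⁆⊆p e∈Y))) ρY≤ρX)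

  cyc-mono : X ⊆ Y → cyc M X ⊆ cyc M Y
  cyc-mono X⊆Y e∈cycX =
    ∈cyc⁺ (X⊆Y (cyc⊆ e∈cycX)) (e∈clX⇒ρY≤ρ[Y-e] (─-monoˡ X⊆Y) (∈cyc⇒∈cl[X-e] e∈cycX))

  cyclic⇒⊆cyc : IsCyclic C → C ⊆ X → C ⊆ cyc M X
  cyclic⇒⊆cyc {C} {X} C-cyclic C⊆X = subst (_⊆ cyc M X) C-cyclic (cyc-mono C⊆X)

  cl─⊆cyc[cl] : cl M X ─ X ⊆ cyc M (cl M X)
  cl─⊆cyc[cl] {X} {e} e∈ = ∈cyc⁺ e∈cl (e∈clX⇒ρY≤ρ[Y-e] (p⊆q∧x∉p⇒p⊆q-x X⊆cl e∉X) e∈cl)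
    where
    e∈cl : e ∈ cl M X
    e∈cl = p─q⊆p (cl M X) X e∈
    e∉X : e ∉ X
    e∉X = x∈p─q⇒x∉q (cl M X) X e∈

  ρ[cl]≤ρ : ∀ X → ρ (cl M X) ≤ ρ X
  ρ[cl]≤ρ X = removal-induction X P (λ Y⊆X _ _ → ρ-mono Y⊆X) step (cl M X) X⊆cl ⊆-refl
    where
    P : Subset n → Set
    P Y = X ⊆ Y → Y ⊆ cl M X → ρ Y ≤ ρ X
    step : ∀ {Y e} → e ∈ Y → e ∉ X → P (Y - e) → P Y
    step {Y} {e} e∈Y e∉X ih X⊆Y Y⊆cl =
      ≤-trans (e∈clX⇒ρY≤ρ[Y-e] X⊆Y-e (Y⊆cl e∈Y)) (ih X⊆Y-e (⊆-trans (p─q⊆p Y ⁅ e ⁆) Y⊆cl))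
      where
      X⊆Y-e : X ⊆ Y - e
      X⊆Y-e = p⊆q∧x∉p⇒p⊆q-x X⊆Y e∉X

  -- The hypothesis cyc Y ⊆ X says that every element of Y ─ X is a coloop of Y.
  cycY⊆X⇒∣Y─X∣+ρX≤ρY : X ⊆ Y → cyc M Y ⊆ X → ∣ Y ─ X ∣ + ρ X ≤ ρ Y
  cycY⊆X⇒∣Y─X∣+ρX≤ρY {X} {Y} = removal-induction X P base step Y
    where
    P : Subset n → Set
    P Y = X ⊆ Y → cyc M Y ⊆ X → ∣ Y ─ X ∣ + ρ X ≤ ρ Y
    base : ∀ {Y} → Y ⊆ X → P Y
    base {Y} Y⊆X X⊆Y _ = subst (_≤ ρ Y) (cong (_+ ρ X) (sym (p⊆q⇒∣p─q∣≡0 Y⊆X))) (ρ-mono X⊆Y)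
    step : ∀ {Y e} → e ∈ Y → e ∉ X → P (Y - e) → P Y
    step {Y} {e} e∈Y e∉X ih X⊆Y cycY⊆X = begin
      ∣ Y ─ X ∣ + ρ X           ≡⟨ cong (_+ ρ X) ∣Y─X∣≡1+∣Y-e─X∣ ⟩
      suc (∣ Y - e ─ X ∣ + ρ X) ≤⟨ s≤s (ih X⊆Y-e (⊆-trans (cyc-mono (p─q⊆p Y ⁅ e ⁆)) cycY⊆X)) ⟩
      suc (ρ (Y - e))           ≤⟨ ∉cyc⇒ρ[X-e]<ρX e∈Y (λ e∈cyc → e∉X (cycY⊆X e∈cyc)) ⟩
      ρ Y                       ∎
      where
      open ≤-Reasoning
      X⊆Y-e : X ⊆ Y - e
      X⊆Y-e = p⊆q∧x∉p⇒p⊆q-x X⊆Y e∉X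
      ∣Y─X∣≡1+∣Y-e─X∣ : ∣ Y ─ X ∣ ≡ suc ∣ Y - e ─ X ∣
      ∣Y─X∣≡1+∣Y-e─X∣ = begin-equality
        ∣ Y ─ X ∣           ≡⟨ sym (x∈p⇒1+∣p-x∣≡∣p∣ (x∈p∧x∉q⇒x∈p─q e∈Y e∉X)) ⟩
        suc ∣ Y ─ X - e ∣   ≡⟨ cong (suc ∘ ∣_∣) (p─q─r≡p─r─q Y X ⁅ e ⁆) ⟩
        suc ∣ Y - e ─ X ∣   ∎

  ηX+ρX≡∣X∣ : ∀ X → η M X + ρ X ≡ ∣ X ∣
  ηX+ρX≡∣X∣ X = m∸n+n≡m (ρ-bounded X)

  X⊆Y⇒ηX≡∣Y∣∸[∣Y─X∣+ρX] : X ⊆ Y → η M X ≡ ∣ Y ∣ ∸ (∣ Y ─ X ∣ + ρ X)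
  X⊆Y⇒ηX≡∣Y∣∸[∣Y─X∣+ρX] {X} {Y} X⊆Y = begin
    ∣ X ∣ ∸ ρ X                             ≡⟨ sym ([m+n]∸[m+o]≡n∸o ∣ Y ─ X ∣ ∣ X ∣ (ρ X)) ⟩
    (∣ Y ─ X ∣ + ∣ X ∣) ∸ (∣ Y ─ X ∣ + ρ X) ≡⟨ cong (_∸ (∣ Y ─ X ∣ + ρ X)) (q⊆p⇒∣p─q∣+∣q∣≡∣p∣ X⊆Y) ⟩
    ∣ Y ∣ ∸ (∣ Y ─ X ∣ + ρ X)               ∎
    where open ≡-Reasoning

  η-mono : X ⊆ Y → η M X ≤ η M Y
  η-mono {X} {Y} X⊆Y =
    ≤-trans (≤-reflexive (X⊆Y⇒ηX≡∣Y∣∸[∣Y─X∣+ρX] X⊆Y)) (∸-monoʳ-≤ ∣ Y ∣ (ρY≤∣Y─X∣+ρX X Y))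

  cycY⊆X⇒ηY≤ηX : X ⊆ Y → cyc M Y ⊆ X → η M Y ≤ η M X
  cycY⊆X⇒ηY≤ηX {X} {Y} X⊆Y cycY⊆X =
    ≤-trans (∸-monoʳ-≤ ∣ Y ∣ (cycY⊆X⇒∣Y─X∣+ρX≤ρY X⊆Y cycY⊆X))
            (≤-reflexive (sym (X⊆Y⇒ηX≡∣Y∣∸[∣Y─X∣+ρX] X⊆Y)))

  cyc-isCyclic : ∀ X → IsCyclic (cyc M X)
  cyc-isCyclic X = ⊆-antisym cyc⊆ (λ e∈c → ∈cyc⁺ e∈c (ρc≤ρ[c-e] e∈c))
    where
    c : Subset n
    c = cyc M X
    ρc≤ρ[c-e] : e ∈ c → ρ c ≤ ρ (c - e)
    ρc≤ρ[c-e] {e} e∈c = +-cancelˡ-≤ ∣ X ─ c ∣ _ _ (begin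
      ∣ X ─ c ∣ + ρ c                  ≤⟨ cycY⊆X⇒∣Y─X∣+ρX≤ρY cyc⊆ ⊆-refl ⟩
      ρ X                              ≤⟨ ∈cyc⁻ e∈c ⟩
      ρ (X - e)                        ≤⟨ ρY≤∣Y─X∣+ρX (c - e) (X - e) ⟩
      ∣ X - e ─ (c - e) ∣ + ρ (c - e)  ≤⟨ +-monoˡ-≤ (ρ (c - e)) (p⊆q⇒∣p∣≤∣q∣ ([p-x]─[q-x]⊆p─q X c e)) ⟩
      ∣ X ─ c ∣ + ρ (c - e)            ∎)
      where open ≤-Reasoning

  cyc-preserves-flat : IsFlat M X → IsFlat M (cyc M X)
  cyc-preserves-flat {X} X-flat = ⊆-antisym cl[c]⊆c X⊆cl
    where
    cl[c]⊆c : cl M (cyc M X) ⊆ cyc M X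
    cl[c]⊆c {e} e∈cl with e ∈? cyc M X
    ... | yes e∈c = e∈c
    ... | no  e∉c = ∈cyc⁺ (cl-least cyc⊆ X-flat e∈cl)
      (e∈clX⇒ρY≤ρ[Y-e] (p⊆q∧x∉p⇒p⊆q-x cyc⊆ e∉c) e∈cl)

  cl-preserves-cyclic : IsCyclic C → IsCyclic (cl M C)
  cl-preserves-cyclic {C} C-cyclic = ⊆-antisym cyc⊆
    (⊆-trans (p⊆q∪[p─q] (cl M C) C) (∪-lub (cyclic⇒⊆cyc C-cyclic X⊆cl) cl─⊆cyc[cl]))

  cl-isFlat : ∀ X → IsFlat M (cl M X)
  cl-isFlat X = ⊆-antisym
    (ρY≤ρX⇒Y⊆clX (⊆-trans X⊆cl X⊆cl) (≤-trans (ρ[cl]≤ρ (cl M X)) (ρ[cl]≤ρ X))) X⊆cl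

  ∪-cyclic : IsCyclic X → IsCyclic Y → IsCyclic (X ∪ Y)
  ∪-cyclic {X} {Y} X-cyclic Y-cyclic = ⊆-antisym cyc⊆
    (∪-lub (cyclic⇒⊆cyc X-cyclic (p⊆p∪q Y)) (cyclic⇒⊆cyc Y-cyclic (q⊆p∪q X Y)))

  ∩-flat : IsFlat M X → IsFlat M Y → IsFlat M (X ∩ Y)
  ∩-flat {X} {Y} X-flat Y-flat = ⊆-antisym
    (∩-glb (cl-least (p∩q⊆p X Y) X-flat) (cl-least (p∩q⊆q X Y) Y-flat)) X⊆cl

  ∨ᶻ-cyclicFlat : IsCyclicFlat M X → IsCyclicFlat M Y → IsCyclicFlat M (_∨ᶻ_ M X Y)
  ∨ᶻ-cyclicFlat (_ , X-cyclic) (_ , Y-cyclic) =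
    cl-isFlat _ , cl-preserves-cyclic (∪-cyclic X-cyclic Y-cyclic)

  ∧ᶻ-cyclicFlat : IsCyclicFlat M X → IsCyclicFlat M Y → IsCyclicFlat M (_∧ᶻ_ M X Y)
  ∧ᶻ-cyclicFlat (X-flat , _) (Y-flat , _) = cyc-preserves-flat (∩-flat X-flat Y-flat) , cyc-isCyclic _

  0ᶻ-cyclicFlat : IsCyclicFlat M (0ᶻ M)
  0ᶻ-cyclicFlat = cl-isFlat ⊥ , cl-preserves-cyclic (⊆-antisym cyc⊆ ⊥⊆)

  1ᶻ-cyclicFlat : IsCyclicFlat M (1ᶻ M)
  1ᶻ-cyclicFlat = cyc-preserves-flat (⊆-antisym ⊆⊤ X⊆cl) , cyc-isCyclic ⊤

  private
    below? : ∀ A Z → Dec (IsCyclicFlat M Z × Z ⊆ A)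
    below? A Z = isCyclicFlat? M Z ×-dec (Z ⊆? A)

    above? : ∀ A Z → Dec (IsCyclicFlat M Z × A ⊆ Z)
    above? A Z = isCyclicFlat? M Z ×-dec (A ⊆? Z)

  ^∨-cyclicFlat : ∀ A → IsCyclicFlat M (_^∨ M A)
  ^∨-cyclicFlat A = foldr-preservesᵇ {P = IsCyclicFlat M} {f = _∨ᶻ_ M}
    ∨ᶻ-cyclicFlat 0ᶻ-cyclicFlat (All.map proj₁ (all-filter (below? A) (allSubsets n)))

  ^∨-upper : IsCyclicFlat M Z → Z ⊆ A → Z ⊆ _^∨ M A
  ^∨-upper {Z} {A} Z-cyclicFlat Z⊆A = foldr-preservesᵒ {P = Z ⊆_} {f = _∨ᶻ_ M} ∨ᶻ-upper (0ᶻ M) _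
    (inj₂ (Any.map ⊆-reflexive (∈-filter⁺ (below? A) (∈-allSubsets Z) (Z-cyclicFlat , Z⊆A))))
    where
    ∨ᶻ-upper : ∀ X Y → Z ⊆ X ⊎ Z ⊆ Y → Z ⊆ _∨ᶻ_ M X Y
    ∨ᶻ-upper X Y (inj₁ Z⊆X) = ⊆-trans Z⊆X (⊆-trans (p⊆p∪q Y) X⊆cl)
    ∨ᶻ-upper X Y (inj₂ Z⊆Y) = ⊆-trans Z⊆Y (⊆-trans (q⊆p∪q X Y) X⊆cl)

  ^∨-least : IsFlat M W → (∀ {Z} → IsCyclicFlat M Z → Z ⊆ A → Z ⊆ W) → _^∨ M A ⊆ W
  ^∨-least {W} {A} W-flat bound = foldr-preservesᵇ {P = _⊆ W} {f = _∨ᶻ_ M}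
    (λ X⊆W Y⊆W → cl-least (∪-lub X⊆W Y⊆W) W-flat) (cl-least ⊥⊆ W-flat)
    (All.map {Q = _⊆ W} (λ (Z-cyclicFlat , Z⊆A) → bound Z-cyclicFlat Z⊆A)
             (all-filter (below? A) (allSubsets n)))

  ^∨-mono : A ⊆ B → _^∨ M A ⊆ _^∨ M B
  ^∨-mono {A} {B} A⊆B = ^∨-least (proj₁ (^∨-cyclicFlat B))
    (λ Z-cyclicFlat Z⊆A → ^∨-upper Z-cyclicFlat (⊆-trans Z⊆A A⊆B))

  ^∧-cyclicFlat : ∀ A → IsCyclicFlat M (_^∧ M A)
  ^∧-cyclicFlat A = foldr-preservesᵇ {P = IsCyclicFlat M} {f = _∧ᶻ_ M}
    ∧ᶻ-cyclicFlat 1ᶻ-cyclicFlat (All.map proj₁ (all-filter (above? A) (allSubsets n)))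

  ^∧-lower : IsCyclicFlat M Z → A ⊆ Z → _^∧ M A ⊆ Z
  ^∧-lower {Z} {A} Z-cyclicFlat A⊆Z = foldr-preservesᵒ {P = _⊆ Z} {f = _∧ᶻ_ M} ∧ᶻ-lower (1ᶻ M) _
    (inj₂ (Any.map (⊆-reflexive ∘ sym) (∈-filter⁺ (above? A) (∈-allSubsets Z) (Z-cyclicFlat , A⊆Z))))
    where
    ∧ᶻ-lower : ∀ X Y → X ⊆ Z ⊎ Y ⊆ Z → _∧ᶻ_ M X Y ⊆ Z
    ∧ᶻ-lower X Y (inj₁ X⊆Z) = ⊆-trans cyc⊆ (⊆-trans (p∩q⊆p X Y) X⊆Z)
    ∧ᶻ-lower X Y (inj₂ Y⊆Z) = ⊆-trans cyc⊆ (⊆-trans (p∩q⊆q X Y) Y⊆Z)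

  ^∧-greatest : IsCyclic C → (∀ {Z} → IsCyclicFlat M Z → A ⊆ Z → C ⊆ Z) → C ⊆ _^∧ M A
  ^∧-greatest {C} {A} C-cyclic bound = foldr-preservesᵇ {P = C ⊆_} {f = _∧ᶻ_ M}
    (λ C⊆X C⊆Y → cyclic⇒⊆cyc C-cyclic (∩-glb C⊆X C⊆Y)) (cyclic⇒⊆cyc C-cyclic ⊆⊤)
    (All.map {Q = C ⊆_} (λ (Z-cyclicFlat , A⊆Z) → bound Z-cyclicFlat A⊆Z)
             (all-filter (above? A) (allSubsets n)))

  flat⇒^∨⊆ : IsFlat M F → _^∨ M F ⊆ F
  flat⇒^∨⊆ F-flat = ^∨-least F-flat (λ _ Z⊆F → Z⊆F)

  flat⇒^∨≡cyc : IsFlat M F → _^∨ M F ≡ cyc M F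
  flat⇒^∨≡cyc {F} F-flat = ⊆-antisym
    (cyclic⇒⊆cyc (proj₂ (^∨-cyclicFlat F)) (flat⇒^∨⊆ F-flat))
    (^∨-upper (cyc-preserves-flat F-flat , cyc-isCyclic F) cyc⊆)

  Empty[cl─]⇒flat : Empty (cl M X ─ X) → IsFlat M X
  Empty[cl─]⇒flat cl─-empty = ⊆-antisym (Empty[p─q]⇒p⊆q cl─-empty) X⊆cl

  cyc[cl]⊆⇒flat : cyc M (cl M X) ⊆ X → IsFlat M X
  cyc[cl]⊆⇒flat {X} cyc[cl]⊆X = ⊆-antisym
    (⊆-trans (p⊆q∪[p─q] (cl M X) X) (∪-lub ⊆-refl (⊆-trans cl─⊆cyc[cl] cyc[cl]⊆X))) X⊆cl

  flat-interval-isFlat : IsFlat M F → _^∨ M F ⊆ B → B ⊆ F → IsFlat M B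
  flat-interval-isFlat {F} {B} F-flat F∨⊆B B⊆F = cyc[cl]⊆⇒flat
    (⊆-trans (cyc-mono (cl-least B⊆F F-flat)) (subst (_⊆ B) (flat⇒^∨≡cyc F-flat) F∨⊆B))

  flat⇒∣∩∣<η[^∨]+ρ : IsFlat M G → IsCyclicFlat M Z → _^∨ M G ⊆ Z → Z ≢ _^∨ M G →
                     ∣ G ∩ Z ∣ < η M (_^∨ M G) + ρ Z
  flat⇒∣∩∣<η[^∨]+ρ {G} {Z} G-flat Z-cyclicFlat G∨⊆Z Z≢G∨ = begin-strict
    ∣ G ∩ Z ∣                 ≡⟨ sym (ηX+ρX≡∣X∣ (G ∩ Z)) ⟩
    η M (G ∩ Z) + ρ (G ∩ Z)   ≤⟨ +-monoˡ-≤ (ρ (G ∩ Z)) (cycY⊆X⇒ηY≤ηX G∨⊆G∩Z cyc[G∩Z]⊆G∨) ⟩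
    η M G∨ + ρ (G ∩ Z)        <⟨ +-monoʳ-< (η M G∨) ρ[G∩Z]<ρZ ⟩
    η M G∨ + ρ Z              ∎
    where
    open ≤-Reasoning
    G∨ : Subset n
    G∨ = _^∨ M G
    G∨⊆G∩Z : G∨ ⊆ G ∩ Z
    G∨⊆G∩Z = ∩-glb (flat⇒^∨⊆ G-flat) G∨⊆Z
    cyc[G∩Z]⊆G∨ : cyc M (G ∩ Z) ⊆ G∨
    cyc[G∩Z]⊆G∨ = subst (cyc M (G ∩ Z) ⊆_) (sym (flat⇒^∨≡cyc G-flat)) (cyc-mono (p∩q⊆p G Z))
    Z⊆G : ρ (G ∩ Z) ≡ ρ Z → Z ⊆ G
    Z⊆G ρ≡ = ⊆-trans (ρY≤ρX⇒Y⊆clX (p∩q⊆q G Z) (≤-reflexive (sym ρ≡))) (cl-least (p∩q⊆p G Z) G-flat)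
    ρ[G∩Z]<ρZ : ρ (G ∩ Z) < ρ Z
    ρ[G∩Z]<ρZ = ≤∧≢⇒< (ρ-mono (p∩q⊆q G Z))
      (λ ρ≡ → Z≢G∨ (⊆-antisym (^∨-upper Z-cyclicFlat (Z⊆G ρ≡)) G∨⊆Z))

  flat⇒∣∣<η[^∨]+ρ[^∧] : IsFlat M G → G ⊂ _^∧ M G → ∣ G ∣ < η M (_^∨ M G) + ρ (_^∧ M G)
  flat⇒∣∣<η[^∨]+ρ[^∧] {G} G-flat (G⊆G∧ , x , x∈G∧ , x∉G) = ≤-<-trans
    (p⊆q⇒∣p∣≤∣q∣ (∩-glb ⊆-refl G⊆G∧))
    (flat⇒∣∩∣<η[^∨]+ρ G-flat (^∧-cyclicFlat G) (⊆-trans (flat⇒^∨⊆ G-flat) G⊆G∧)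
      (λ G∧≡G∨ → x∉G (flat⇒^∨⊆ G-flat (subst (x ∈_) G∧≡G∨ x∈G∧))))

  flat-interval⇒∣∣<η[^∨]+ρ[^∧] : IsFlat M F → _^∨ M F ⊆ B → B ⊆ F → B ⊂ _^∧ M B →
                                ∣ B ∣ < η M (_^∨ M B) + ρ (_^∧ M B)
  flat-interval⇒∣∣<η[^∨]+ρ[^∧] F-flat F∨⊆B B⊆F =
    flat⇒∣∣<η[^∨]+ρ[^∧] (flat-interval-isFlat F-flat F∨⊆B B⊆F)

  module NonFlat {F : Subset n} (F∨⊆F : _^∨ M F ⊆ F) {e : Fin n} (e∈clF─F : e ∈ cl M F ─ F) where

    private
      Zᶠ : Subset n
      Zᶠ = cyc M (cl M F)

      Zᶠ-cyclicFlat : IsCyclicFlat M Zᶠ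
      Zᶠ-cyclicFlat = cyc-preserves-flat (cl-isFlat F) , cyc-isCyclic (cl M F)

      e∉F : e ∉ F
      e∉F = x∈p─q⇒x∉q (cl M F) F e∈clF─F

      e∈Zᶠ : e ∈ Zᶠ
      e∈Zᶠ = cl─⊆cyc[cl] e∈clF─F

      F∨⊆F∩Zᶠ : _^∨ M F ⊆ F ∩ Zᶠ
      F∨⊆F∩Zᶠ = ∩-glb F∨⊆F (cyclic⇒⊆cyc (proj₂ (^∨-cyclicFlat F)) (⊆-trans F∨⊆F X⊆cl))

      ρZᶠ≤ρ[F∩Zᶠ] : ρ Zᶠ ≤ ρ (F ∩ Zᶠ)
      ρZᶠ≤ρ[F∩Zᶠ] = +-cancelˡ-≤ ∣ cl M F ─ Zᶠ ∣ _ _ (begin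
        ∣ cl M F ─ Zᶠ ∣ + ρ Zᶠ         ≤⟨ cycY⊆X⇒∣Y─X∣+ρX≤ρY cyc⊆ ⊆-refl ⟩
        ρ (cl M F)                     ≤⟨ ρ[cl]≤ρ F ⟩
        ρ F                            ≤⟨ ρY≤∣Y─X∣+ρX (F ∩ Zᶠ) F ⟩
        ∣ F ─ (F ∩ Zᶠ) ∣ + ρ (F ∩ Zᶠ) ≤⟨ +-monoˡ-≤ (ρ (F ∩ Zᶠ)) (p⊆q⇒∣p∣≤∣q∣ F─[F∩Zᶠ]⊆clF─Zᶠ) ⟩
        ∣ cl M F ─ Zᶠ ∣ + ρ (F ∩ Zᶠ)  ∎)
        where
        open ≤-Reasoning
        F─[F∩Zᶠ]⊆clF─Zᶠ : F ─ (F ∩ Zᶠ) ⊆ cl M F ─ Zᶠ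
        F─[F∩Zᶠ]⊆clF─Zᶠ = ⊆-trans (p─[p∩q]⊆p─q F Zᶠ) (─-monoˡ X⊆cl)

      η[F∨]+ρZᶠ≤∣F∩Zᶠ∣ : η M (_^∨ M F) + ρ Zᶠ ≤ ∣ F ∩ Zᶠ ∣
      η[F∨]+ρZᶠ≤∣F∩Zᶠ∣ = begin
        η M (_^∨ M F) + ρ Zᶠ         ≤⟨ +-mono-≤ (η-mono F∨⊆F∩Zᶠ) ρZᶠ≤ρ[F∩Zᶠ] ⟩
        η M (F ∩ Zᶠ) + ρ (F ∩ Zᶠ)   ≡⟨ ηX+ρX≡∣X∣ (F ∩ Zᶠ) ⟩
        ∣ F ∩ Zᶠ ∣                   ∎
        where open ≤-Reasoning

    ¬condition-iii : ¬ (∀ Z → _∈Z′_ M Z F → Z ≢ _^∨ M F → ∣ F ∩ Z ∣ < η M (_^∨ M F) + ρ Z)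
    ¬condition-iii condition =
      <⇒≱ (condition Zᶠ (Zᶠ-cyclicFlat , ⊆-trans F∨⊆F∩Zᶠ (p∩q⊆q F Zᶠ) , Zᶠ⊆F∧) Zᶠ≢F∨) η[F∨]+ρZᶠ≤∣F∩Zᶠ∣
      where
      Zᶠ⊆F∧ : Zᶠ ⊆ _^∧ M F
      Zᶠ⊆F∧ = ^∧-greatest (proj₂ Zᶠ-cyclicFlat)
        (λ W-cyclicFlat F⊆W → ⊆-trans cyc⊆ (cl-least F⊆W (proj₁ W-cyclicFlat)))
      Zᶠ≢F∨ : Zᶠ ≢ _^∨ M F
      Zᶠ≢F∨ Zᶠ≡F∨ = e∉F (F∨⊆F (subst (e ∈_) Zᶠ≡F∨ e∈Zᶠ))

    ¬condition-v : ¬ (∀ B → _^∨ M F ⊆ B → B ⊆ F → B ⊂ _^∧ M B →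
                      ∣ B ∣ < η M (_^∨ M B) + ρ (_^∧ M B))
    ¬condition-v condition =
      <⇒≱ (condition (F ∩ Zᶠ) F∨⊆F∩Zᶠ (p∩q⊆p F Zᶠ) F∩Zᶠ⊂[F∩Zᶠ]∧) (begin
        η M (_^∨ M (F ∩ Zᶠ)) + ρ (_^∧ M (F ∩ Zᶠ))
          ≤⟨ +-mono-≤ (η-mono (^∨-mono (p∩q⊆p F Zᶠ))) (ρ-mono (^∧-lower Zᶠ-cyclicFlat (p∩q⊆q F Zᶠ))) ⟩
        η M (_^∨ M F) + ρ Zᶠ
          ≤⟨ η[F∨]+ρZᶠ≤∣F∩Zᶠ∣ ⟩
        ∣ F ∩ Zᶠ ∣
          ∎)
      where
      open ≤-Reasoning
      Zᶠ⊆[F∩Zᶠ]∧ : Zᶠ ⊆ _^∧ M (F ∩ Zᶠ)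
      Zᶠ⊆[F∩Zᶠ]∧ = ^∧-greatest (proj₂ Zᶠ-cyclicFlat) (λ W-cyclicFlat F∩Zᶠ⊆W →
        ⊆-trans (ρY≤ρX⇒Y⊆clX (p∩q⊆q F Zᶠ) ρZᶠ≤ρ[F∩Zᶠ]) (cl-least F∩Zᶠ⊆W (proj₁ W-cyclicFlat)))
      F∩Zᶠ⊂[F∩Zᶠ]∧ : F ∩ Zᶠ ⊂ _^∧ M (F ∩ Zᶠ)
      F∩Zᶠ⊂[F∩Zᶠ]∧ = ⊆-trans (p∩q⊆q F Zᶠ) Zᶠ⊆[F∩Zᶠ]∧ , e , Zᶠ⊆[F∩Zᶠ]∧ e∈Zᶠ , e∉F ∘ p∩q⊆p F Zᶠ

proposition5p9 : {n : ℕ} (M : Matroid n) (F : Subset n) →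
  _^∨ M F ⊆ F →
  let open Matroid M
      F∨ = _^∨ M F
  in
  -- (i) ⇔ (ii)
  (IsFlat M F ⇔ (F∨ ≡ cyc M (cl M F)))
  ×
  -- (i) ⇔ (iii)
  (IsFlat M F ⇔
    (∀ Z → _∈Z′_ M Z F → Z ≢ F∨ →
      ∣ F ∩ Z ∣ < η M F∨ + ρ Z))
  ×
  -- (i) ⇔ (iv)
  (IsFlat M F ⇔
    ((∀ B → F∨ ⊆ B → B ⊆ F → IsFlat M B)
     × (F ⊂ _^∧ M F → ∣ F ∣ < η M F∨ + ρ (_^∧ M F))))
  ×
  -- (i) ⇔ (v)
  (IsFlat M F ⇔
    (∀ B → F∨ ⊆ B → B ⊆ F → B ⊂ _^∧ M B →
      ∣ B ∣ < η M (_^∨ M B) + ρ (_^∧ M B)))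
proposition5p9 M F F∨⊆F =
  mk⇔ (λ F-flat → trans (flat⇒^∨≡cyc M F-flat) (cong (cyc M) (sym F-flat)))
      (λ F∨≡ → cyc[cl]⊆⇒flat M (subst (_⊆ F) F∨≡ F∨⊆F)) ,
  mk⇔ (λ F-flat Z (Z-cyclicFlat , F∨⊆Z , _) → flat⇒∣∩∣<η[^∨]+ρ M F-flat Z-cyclicFlat F∨⊆Z)
      (λ condition → Empty[cl─]⇒flat M (λ (_ , e∈) → NonFlat.¬condition-iii M F∨⊆F e∈ condition)) ,
  mk⇔ (λ F-flat → (λ _ → flat-interval-isFlat M F-flat) , flat⇒∣∣<η[^∨]+ρ[^∧] M F-flat)
      (λ (interval-flat , _) → interval-flat F F∨⊆F ⊆-refl) ,
  mk⇔ (λ F-flat _ → flat-interval⇒∣∣<η[^∨]+ρ[^∧] M F-flat)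
      (λ condition → Empty[cl─]⇒flat M (λ (_ , e∈) → NonFlat.¬condition-v M F∨⊆F e∈ condition))
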